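{- Let $f:\mathbb{B}^n\to\mathbb{B}^n$ be a Boolean network in which component $n$ is not autoregulated, let $P\in\{0,1,\star\}^n$ be a phenotype subspace, and let $S\in\{0,1,\star\}^n$ be an MTS-control strategy for $(f,P)$ with $S_n=\star$. Suppose that for each minimal trap space $T'$ of $\widetilde{C(f,S)}$ there exists a minimal trap space $T$ of $C(f,S)$ such that $T'\subseteq T_{[n-1]}$. Then $S_{[n-1]}$ is an MTS-control strategy for $(\tilde f,P_{[n-1]})$.
   Context: $\mathbb{B}=\{0,1\}$, $[n]=\{1,\dots,n\}$. For $x\in\mathbb{B}^n$, $\bar x^i$ is $x$ with coordinate $i$ flipped. Component $i$ regulates $j$ if $g_j(x)\neq g_j(\bar x^i)$ for some $x$ (for a network $g$); $n$ is autoregulated if it regulates itself. A subspace is a set $\{x: x_i=c(i)\ \forall i\in I\}$, written as $S\in\{0,1,\star\}^n$ with $S_i=c(i)$ on $I$ (fixed) and $\star$ elsewhere (free); $A_J$ is projection onto coordinates $J$. A trap space of $g$ is a subspace $T$ with $g(T)\subseteq T$; minimal if no trap space is strictly contained in it. Reduction of $g$ (with $n$ not autoregulated): $\sigma(x)=(x,g_n(x,0))$ and $\tilde g_i(x)=g_i(\sigma(x))$ for $x\in\mathbb{B}^{n-1}$, $i\in[n-1]$. Control: $C(g,S)_i=g_i$ if $i$ is free in $S$ and $C(g,S)_i\equiv S_i$ if $i$ is fixed in $S$. A subspace $S$ is an MTS-control strategy for $(g,P)$ if all minimal trap spaces of $C(g,S)$ are contained in $P$. -}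

module Defs where

open import Data.Bool using (Bool; true; false; not)
open import Data.Fin using (Fin; zero; suc; fromℕ; inject₁; _≟_)
open import Data.Nat using (ℕ; zero; suc)
open import Data.Product using (Σ; ∃; _×_)
open import Relation.Binary.PropositionalEquality using (_≡_; _≢_)
open import Relation.Nullary using (yes; no)

State : ℕ → Set
State n = Fin n → Bool

BN : ℕ → Set
BN n = State n → State n

flipAt : ∀ {n} → State n → Fin n → State n
flipAt x i j with i ≟ j
... | yes _ = not (x j)
... | no  _ = x j

Regulates : ∀ {n} → BN n → Fin n → Fin n → Set
Regulates g i j = ∃ λ x → g x j ≢ g (flipAt x i) j

lastIx : ∀ {m} → Fin (suc m)
lastIx {m} = fromℕ m

-- (x , b) ∈ 𝔹^(m+1) for x ∈ 𝔹^m, b ∈ 𝔹 (b placed in the last coordinate)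
snoc : ∀ {m} {A : Set} → (Fin m → A) → A → Fin (suc m) → A
snoc {zero}  x b zero    = b
snoc {suc m} x b zero    = x zero
snoc {suc m} x b (suc i) = snoc (λ j → x (suc j)) b i

proj : ∀ {m} {A : Set} → (Fin (suc m) → A) → Fin m → A
proj x i = x (inject₁ i)

data Entry : Set where
  fixed : Bool → Entry
  ⋆     : Entry

Subspace : ℕ → Set
Subspace n = Fin n → Entry

_∈S_ : ∀ {n} → State n → Subspace n → Set
x ∈S S = ∀ i b → S i ≡ fixed b → x i ≡ b

_⊆S_ : ∀ {n} → Subspace n → Subspace n → Set
S ⊆S T = ∀ x → x ∈S S → x ∈S T

IsTrapSpace : ∀ {n} → BN n → Subspace n → Set
IsTrapSpace g T = ∀ x → x ∈S T → g x ∈S T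

IsMinTrapSpace : ∀ {n} → BN n → Subspace n → Set
IsMinTrapSpace g T =
  IsTrapSpace g T × (∀ T' → IsTrapSpace g T' → T' ⊆S T → T ⊆S T')

-- reduction of g eliminating the last component:
-- σ(x) = (x, g_n(x,0)),  g̃_i(x) = g_i(σ(x))
reduce : ∀ {m} → BN (suc m) → BN m
reduce g x i = g (snoc x (g (snoc x false) lastIx)) (inject₁ i)

control : ∀ {n} → BN n → Subspace n → BN n
control g S x i with S i
... | fixed b = b
... | ⋆       = g x i

IsMTSControl : ∀ {n} → BN n → Subspace n → Subspace n → Set
IsMTSControl g S P = ∀ T → IsMinTrapSpace (control g S) T → T ⊆S P

-- Since S leaves the last component free, reducing the controlled network C(f,S) gives
-- the same network as controlling the reduced network f̃ by S_[n-1].  So every minimal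
-- trap space T' of C(f̃,S_[n-1]) lies in A_[n-1](T) for some minimal trap space T of
-- C(f,S), and T ⊆ P because S is an MTS-control strategy; projecting gives T' ⊆ P_[n-1].
module Submission where

open import Defs
open import Data.Bool using (Bool; false)
open import Data.Fin using (Fin; zero; suc; inject₁)
open import Data.Nat using (ℕ; zero; suc)
open import Data.Product using (∃; _×_; _,_)
open import Data.Sum using (_⊎_; inj₁; inj₂)
open import Relation.Binary.PropositionalEquality
  using (_≡_; _≗_; refl; sym; trans; cong)
open import Relation.Nullary using (¬_)

snoc-inject₁ : ∀ {m} {A : Set} (x : Fin m → A) (b : A) (i : Fin m) →
               snoc x b (inject₁ i) ≡ x i
snoc-inject₁ {suc m} x b zero    = refl
snoc-inject₁ {suc m} x b (suc i) = snoc-inject₁ (λ j → x (suc j)) b i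

snoc-lastIx : ∀ {m} {A : Set} (x : Fin m → A) (b : A) → snoc x b lastIx ≡ b
snoc-lastIx {zero}  x b = refl
snoc-lastIx {suc m} x b = snoc-lastIx (λ j → x (suc j)) b

inject₁-or-lastIx : ∀ {m} (j : Fin (suc m)) → (∃ λ i → j ≡ inject₁ i) ⊎ j ≡ lastIx
inject₁-or-lastIx {zero}  zero    = inj₂ refl
inject₁-or-lastIx {suc m} zero    = inj₁ (zero , refl)
inject₁-or-lastIx {suc m} (suc j) with inject₁-or-lastIx j
... | inj₁ (i , j≡i) = inj₁ (suc i , cong suc j≡i)
... | inj₂ j≡last    = inj₂ (cong suc j≡last)

_≐_ : ∀ {n} → BN n → BN n → Set
g ≐ h = ∀ x → g x ≗ h x

∈S-resp-≗ : ∀ {n} {x y : State n} {T : Subspace n} → x ≗ y → x ∈S T → y ∈S T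
∈S-resp-≗ x≗y x∈T i b Ti≡b = trans (sym (x≗y i)) (x∈T i b Ti≡b)

IsTrapSpace-resp-≐ : ∀ {n} {g h : BN n} {T : Subspace n} →
                     g ≐ h → IsTrapSpace g T → IsTrapSpace h T
IsTrapSpace-resp-≐ g≐h trap x x∈T = ∈S-resp-≗ (g≐h x) (trap x x∈T)

IsMinTrapSpace-resp-≐ : ∀ {n} {g h : BN n} {T : Subspace n} →
                        g ≐ h → IsMinTrapSpace g T → IsMinTrapSpace h T
IsMinTrapSpace-resp-≐ g≐h (trap , minimal) =
  IsTrapSpace-resp-≐ g≐h trap ,
  λ T' trap' → minimal T' (IsTrapSpace-resp-≐ (λ x i → sym (g≐h x i)) trap')

control-free : ∀ {n} (g : BN n) (S : Subspace n) x i → S i ≡ ⋆ → control g S x i ≡ g x i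
control-free g S x i Si≡⋆ rewrite Si≡⋆ = refl

reduce-control : ∀ {m} (f : BN (suc m)) (S : Subspace (suc m)) → S lastIx ≡ ⋆ →
                 control (reduce f) (proj S) ≐ reduce (control f S)
reduce-control f S last-free x i
  rewrite control-free f S (snoc x false) lastIx last-free
  with S (inject₁ i)
... | fixed b = refl
... | ⋆       = refl

-- A point of T fixing the last coordinate however T does; ⋆ gets an arbitrary value.
pointAt : Entry → Bool
pointAt (fixed b) = b
pointAt ⋆         = false

snoc-∈S : ∀ {m} {x : State m} (T : Subspace (suc m)) →
          x ∈S proj T → snoc x (pointAt (T lastIx)) ∈S T
snoc-∈S {x = x} T x∈T j b Tj≡b with inject₁-or-lastIx j
... | inj₁ (i , refl) = trans (snoc-inject₁ x _ i) (x∈T i b Tj≡b)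
... | inj₂ refl       = trans (snoc-lastIx x _) (pointAt-fixed Tj≡b)
  where
  pointAt-fixed : ∀ {e b} → e ≡ fixed b → pointAt e ≡ b
  pointAt-fixed refl = refl

proj-⊆S : ∀ {m} {T P : Subspace (suc m)} → T ⊆S P → proj T ⊆S proj P
proj-⊆S {T = T} T⊆P x x∈T i b Pi≡b =
  trans (sym (snoc-inject₁ x _ i)) (T⊆P _ (snoc-∈S T x∈T) (inject₁ i) b Pi≡b)

⊆S-trans : ∀ {n} {R S T : Subspace n} → R ⊆S S → S ⊆S T → R ⊆S T
⊆S-trans R⊆S S⊆T x x∈R = S⊆T x (R⊆S x x∈R)

proposition3 : (m : ℕ) (f : BN (suc m)) (P S : Subspace (suc m))
    → ¬ Regulates f lastIx lastIx
    → IsMTSControl f S P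
    → S lastIx ≡ ⋆
    → (∀ T' → IsMinTrapSpace (reduce (control f S)) T'
         → ∃ λ T → IsMinTrapSpace (control f S) T × (T' ⊆S proj T))
    → IsMTSControl (reduce f) (proj S) (proj P)
proposition3 m f P S _ S-controls last-free lift T' T'-min
  with lift T' (IsMinTrapSpace-resp-≐ (reduce-control f S last-free) T'-min)
... | T , T-min , T'⊆T = ⊆S-trans T'⊆T (proj-⊆S (S-controls T T-min))
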